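{- Let $L$ be a finite lattice and let $C:\hat{0}=x_0\lessdot x_1\lessdot\cdots\lessdot x_n=\hat{1}$ be a saturated $\hat{0}$--$\hat{1}$ chain which is left-modular. Then $C$ satisfies the meet condition.
   Context: A pair $(x,z)$ of elements of $L$ is a modular pair if for all $y\leq z$, $y\vee(x\wedge z)=(y\vee x)\wedge z$. A multichain $C:\hat{0}=x_0\leq\cdots\leq x_n=\hat{1}$ is left-modular if $(x_i,z)$ is a modular pair for every $x_i\in C$ and every $z\in L$. An element is atomic if it is a join of atoms. $C$ satisfies the meet condition if for every atomic $x\in L$ that is neither $\hat{0}$ nor an atom, letting $i$ be the index with $x\leq x_i$ and $x\not\leq x_{i-1}$, we have $x\wedge x_{i-1}\neq\hat{0}$. -}

module Defs where

open import Level using (Level; _⊔_)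
open import Data.Nat using (ℕ; suc)
open import Data.Fin using (Fin; zero; suc; inject₁; fromℕ)
open import Data.List using (List; foldr)
open import Data.List.Relation.Unary.All using (All)
open import Data.Product using (Σ; ∃; _×_)
open import Relation.Nullary using (¬_)
open import Relation.Binary.PropositionalEquality as ≡ using ()
open import Function.Bundles using (Surjection)
open import Relation.Binary.Lattice.Bundles using (BoundedLattice)

module _ {c ℓ₁ ℓ₂ : Level} (L : BoundedLattice c ℓ₁ ℓ₂) where
  open BoundedLattice L

  IsFinite : Set (c ⊔ ℓ₁)
  IsFinite = Σ ℕ λ k → Surjection (≡.setoid (Fin k)) setoid

  _<_ : Carrier → Carrier → Set (ℓ₁ ⊔ ℓ₂)
  a < b = a ≤ b × ¬ (a ≈ b)

  _⋖_ : Carrier → Carrier → Set (c ⊔ ℓ₁ ⊔ ℓ₂)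
  a ⋖ b = a < b × ¬ (∃ λ z → a < z × z < b)

  IsAtom : Carrier → Set (c ⊔ ℓ₁ ⊔ ℓ₂)
  IsAtom a = ⊥ ⋖ a

  IsAtomic : Carrier → Set (c ⊔ ℓ₁ ⊔ ℓ₂)
  IsAtomic x = Σ (List Carrier) λ as → All IsAtom as × (foldr _∨_ ⊥ as ≈ x)

  ModularPair : Carrier → Carrier → Set (c ⊔ ℓ₁ ⊔ ℓ₂)
  ModularPair x z = ∀ y → y ≤ z → (y ∨ (x ∧ z)) ≈ ((y ∨ x) ∧ z)

  IsSaturatedChain : (n : ℕ) → (Fin (suc n) → Carrier) → Set (c ⊔ ℓ₁ ⊔ ℓ₂)
  IsSaturatedChain n x =
    (x zero ≈ ⊥) × (x (fromℕ n) ≈ ⊤) × (∀ (i : Fin n) → x (inject₁ i) ⋖ x (suc i))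

  IsLeftModular : (n : ℕ) → (Fin (suc n) → Carrier) → Set (c ⊔ ℓ₁ ⊔ ℓ₂)
  IsLeftModular n x = ∀ (i : Fin (suc n)) (z : Carrier) → ModularPair (x i) z

  -- meet condition: for atomic x ≠ 0̂ not an atom, and i with x ≤ x_i, x ≰ x_{i-1},
  -- x ∧ x_{i-1} ≠ 0̂.  (Index i ≥ 1 written as suc j, x_{i-1} = x (inject₁ j).)
  MeetCondition : (n : ℕ) → (Fin (suc n) → Carrier) → Set (c ⊔ ℓ₁ ⊔ ℓ₂)
  MeetCondition n x = ∀ (a : Carrier) → IsAtomic a → ¬ (a ≈ ⊥) → ¬ IsAtom a →
    ∀ (j : Fin n) → a ≤ x (suc j) → ¬ (a ≤ x (inject₁ j)) →
    ¬ ((a ∧ x (inject₁ j)) ≈ ⊥)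

-- Take an atom p ≤ a and write y = x_{i-1} ⋖ t = x_i.  If a ∧ y = 0̂ then p ≰ y, so
-- y < p ∨ y ≤ t and the covering forces p ∨ y = t ≥ a.  Modularity of the pair (y, a)
-- then gives a = (p ∨ y) ∧ a = p ∨ (y ∧ a) = p, so a would be an atom.
module Submission where

open import Defs hiding (_<_; _⋖_)
import Defs
open import Level using (Level; _⊔_)
open import Data.Nat using (ℕ; suc)
open import Data.Fin using (Fin; inject₁)
open import Data.List using ([]; _∷_)
open import Data.List.Relation.Unary.All using (_∷_)
open import Data.Product using (∃; _×_; _,_; proj₁; proj₂)
open import Relation.Nullary using (¬_; contradiction)
open import Relation.Binary.Lattice.Bundles using (BoundedLattice; module BoundedLattice)

module _ {c ℓ₁ ℓ₂ : Level} (L : BoundedLattice c ℓ₁ ℓ₂) where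
  open BoundedLattice L
  open import Relation.Binary.Properties.Poset poset using (<-respʳ-≈)
  open import Relation.Binary.Lattice.Properties.MeetSemilattice meetSemilattice
    using (∧-comm; y≤x⇒x∧y≈y)
  open import Relation.Binary.Lattice.Properties.JoinSemilattice joinSemilattice
    using (∨-cong)
  open import Relation.Binary.Lattice.Properties.BoundedJoinSemilattice boundedJoinSemilattice
    using (identityʳ)
  open import Relation.Binary.Reasoning.Setoid setoid

  infix 4 _<_ _⋖_

  _<_ : Carrier → Carrier → Set (ℓ₁ ⊔ ℓ₂)
  _<_ = Defs._<_ L

  _⋖_ : Carrier → Carrier → Set (c ⊔ ℓ₁ ⊔ ℓ₂)
  _⋖_ = Defs._⋖_ L

  ⋖-respʳ-≈ : ∀ {a b b′} → b ≈ b′ → a ⋖ b → a ⋖ b′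
  ⋖-respʳ-≈ b≈b′ (a<b , nothing-between) =
    <-respʳ-≈ b≈b′ a<b ,
    λ { (z , a<z , z<b′) → nothing-between (z , a<z , <-respʳ-≈ (Eq.sym b≈b′) z<b′) }

  ⋖-squeeze : ∀ {a z b} → a ⋖ b → a < z → z ≤ b → ¬ ¬ z ≈ b
  ⋖-squeeze (_ , nothing-between) a<z z≤b z≉b = nothing-between (_ , a<z , z≤b , z≉b)

  x≰y⇒y<x∨y : ∀ {x y} → ¬ x ≤ y → y < x ∨ y
  x≰y⇒y<x∨y {x} {y} x≰y =
    y≤x∨y x y , λ y≈x∨y → x≰y (trans (x≤x∨y x y) (reflexive (Eq.sym y≈x∨y)))

  ≤-disjoint⇒≈⊥ : ∀ {p a y} → p ≤ a → p ≤ y → a ∧ y ≈ ⊥ → p ≈ ⊥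
  ≤-disjoint⇒≈⊥ p≤a p≤y a∧y≈⊥ =
    antisym (trans (∧-greatest p≤a p≤y) (reflexive a∧y≈⊥)) (minimum _)

  atomic-≉⊥⇒atom-below : ∀ {a} → IsAtomic L a → ¬ a ≈ ⊥ → ∃ λ p → IsAtom L p × p ≤ a
  atomic-≉⊥⇒atom-below ([] , _ , ⊥≈a) a≉⊥ = contradiction (Eq.sym ⊥≈a) a≉⊥
  atomic-≉⊥⇒atom-below (p ∷ _ , p-atom ∷ _ , join≈a) _ =
    p , p-atom , trans (x≤x∨y p _) (reflexive join≈a)

  modular-disjoint⇒≈ : ∀ {y a p} → ModularPair L y a → p ≤ a → a ≤ p ∨ y → a ∧ y ≈ ⊥ →
                       a ≈ p
  modular-disjoint⇒≈ {y} {a} {p} modular p≤a a≤p∨y a∧y≈⊥ = begin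
    a              ≈⟨ Eq.sym (y≤x⇒x∧y≈y a≤p∨y) ⟩
    (p ∨ y) ∧ a    ≈⟨ Eq.sym (modular p p≤a) ⟩
    p ∨ (y ∧ a)    ≈⟨ ∨-cong Eq.refl (Eq.trans (∧-comm y a) a∧y≈⊥) ⟩
    p ∨ ⊥          ≈⟨ identityʳ p ⟩
    p              ∎

  covered-modular-disjoint⇒¬¬atom : ∀ {y t a p} → y ⋖ t → ModularPair L y a →
                                     IsAtom L p → p ≤ a → a ≤ t → a ∧ y ≈ ⊥ →
                                     ¬ ¬ IsAtom L a
  covered-modular-disjoint⇒¬¬atom {y} {t} {a} {p} y⋖t modular p-atom p≤a a≤t a∧y≈⊥ a-not-atom =
    ⋖-squeeze y⋖t (x≰y⇒y<x∨y p≰y) p∨y≤t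
      (λ p∨y≈t → a-not-atom (⋖-respʳ-≈ (Eq.sym (a≈p p∨y≈t)) p-atom))
    where
    p≰y : ¬ p ≤ y
    p≰y p≤y = proj₂ (proj₁ p-atom) (Eq.sym (≤-disjoint⇒≈⊥ p≤a p≤y a∧y≈⊥))

    p∨y≤t : p ∨ y ≤ t
    p∨y≤t = ∨-least (trans p≤a a≤t) (proj₁ (proj₁ y⋖t))

    a≈p : p ∨ y ≈ t → a ≈ p
    a≈p p∨y≈t = modular-disjoint⇒≈ modular p≤a (trans a≤t (reflexive (Eq.sym p∨y≈t))) a∧y≈⊥

lemma5p6 : {c ℓ₁ ℓ₂ : Level} (L : BoundedLattice c ℓ₁ ℓ₂) → IsFinite L →
    (n : ℕ) (x : Fin (suc n) → BoundedLattice.Carrier L) →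
    IsSaturatedChain L n x → IsLeftModular L n x → MeetCondition L n x
lemma5p6 L _ n x (_ , _ , cover) left-modular a a-atomic a≉⊥ a-not-atom j a≤xᵢ _ a∧xᵢ₋₁≈⊥ =
  let p , p-atom , p≤a = atomic-≉⊥⇒atom-below L a-atomic a≉⊥
  in  covered-modular-disjoint⇒¬¬atom L (cover j) (left-modular (inject₁ j) a)
        p-atom p≤a a≤xᵢ a∧xᵢ₋₁≈⊥ a-not-atom
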